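{- Let $S$ be a set, $\to\subseteq S\times S$ a binary relation, $n_0,n_1\in\mathbb{N}$, $Q\subseteq S\times S$ and $s_0,s_1\in S$. If $s_0\in\mathrm{EvN}_{\to}\big(n_0,\{s_0'\mid s_1\in\mathrm{EvN}_{\to}(n_1,\{s_1'\mid (s_0',s_1')\in Q\})\}\big)$, then $s_1\in\mathrm{EvN}_{\to}\big(n_1,\{s_1'\mid s_0\in\mathrm{EvN}_{\to}(n_0,\{s_0'\mid (s_0',s_1')\in Q\})\}\big)$.
   Context: For $n\in\mathbb{N}$, $\to^n$ denotes the $n$-fold composition of $\to$, with $\to^0$ the identity relation on $S$. For $n\in\mathbb{N}$ and $Q\subseteq S$, $\mathrm{EvN}_{\to}(n,Q)=\{s\in S\mid (\forall s'.\ s\to^n s'\Rightarrow s'\in Q)\ \wedge\ (\forall s'\,\forall l\in\mathbb{N}.\ l<n\wedge s\to^l s'\Rightarrow\exists s''.\ s'\to s'')\}$. -}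

module Defs where

open import Data.Nat using (ℕ; zero; suc; _<_)
open import Data.Product using (Σ; ∃; _×_)
open import Relation.Binary.PropositionalEquality using (_≡_)

iterate : {S : Set} → (S → S → Set) → ℕ → S → S → Set
iterate R zero    s s' = s ≡ s'
iterate R (suc n) s s' = Σ _ λ t → R s t × iterate R n t s'

EvN : {S : Set} → (S → S → Set) → ℕ → (S → Set) → S → Set
EvN R n Q s =
  (∀ s' → iterate R n s s' → Q s') ×
  (∀ s' (l : ℕ) → l < n → iterate R l s s' → ∃ λ s'' → R s' s'')

{-# OPTIONS --safe #-}
module Submission where

open import Defs
open import Data.Nat using (ℕ; zero; suc; _<_; s≤s; z≤n)
open import Data.Product using (_×_; _,_; ∃)
open import Relation.Binary.PropositionalEquality using (refl)

-- The postconditions commute by swapping the two universal quantifiers. The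
-- n₁-step progress of s₁ is supplied by any s₀ reached in n₀ steps, and such
-- a state exists because s₀ cannot get stuck before n₀ steps.

NonBlockingFor : {S : Set} → (S → S → Set) → ℕ → S → Set
NonBlockingFor R n s = ∀ s' (l : ℕ) → l < n → iterate R l s s' → ∃ λ s'' → R s' s''

nonBlockingFor⇒∃-iterate : {S : Set} (R : S → S → Set) (n : ℕ) (s : S) →
  NonBlockingFor R n s → ∃ λ s' → iterate R n s s'
nonBlockingFor⇒∃-iterate R zero    s _    = s , refl
nonBlockingFor⇒∃-iterate R (suc n) s prog with prog s 0 (s≤s z≤n) refl
... | t , s→t with nonBlockingFor⇒∃-iterate R n t
                     (λ s' l l<n t→ˡs' → prog s' (suc l) (s≤s l<n) (t , s→t , t→ˡs'))
... | u , t→ⁿu = u , t , s→t , t→ⁿu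

EvN⇒∃-iterate-satisfying : {S : Set} (R : S → S → Set) (n : ℕ) (Q : S → Set) (s : S) →
  EvN R n Q s → ∃ λ s' → iterate R n s s' × Q s'
EvN⇒∃-iterate-satisfying R n Q s (post , prog) =
  let s' , s→ⁿs' = nonBlockingFor⇒∃-iterate R n s prog in s' , s→ⁿs' , post s' s→ⁿs'

mainTheorem3 : (S : Set) (R : S → S → Set) (n₀ n₁ : ℕ) (Q : S → S → Set) (s₀ s₁ : S) →
    EvN R n₀ (λ s₀' → EvN R n₁ (λ s₁' → Q s₀' s₁') s₁) s₀ →
    EvN R n₁ (λ s₁' → EvN R n₀ (λ s₀' → Q s₀' s₁') s₀) s₁
mainTheorem3 S R n₀ n₁ Q s₀ s₁ ev@(post₀ , prog₀) = post₁ , prog₁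
  where
  post₁ : ∀ s₁' → iterate R n₁ s₁ s₁' → EvN R n₀ (λ s₀' → Q s₀' s₁') s₀
  post₁ s₁' s₁→s₁' = (λ s₀' s₀→s₀' → let post , _ = post₀ s₀' s₀→s₀' in post s₁' s₁→s₁') , prog₀

  prog₁ : NonBlockingFor R n₁ s₁
  prog₁ = let _ , _ , (_ , prog) = EvN⇒∃-iterate-satisfying R n₀ _ s₀ ev in prog
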